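{- Every finitely generated submonoid of $\mathrm{FPT}$ is finite.
   Context: A tree is a nonempty prefix-closed set $A\subseteq(\mathbb N^+)^*$ with $wj\in A$, $i<j$ implying $wi\in A$. A permutation tree is a map $t:A\to\mathrm{Sym}(\mathbb N^+)$ such that a node with exactly $n$ children has label in $S_n$ (permutations of $\mathbb N^+$ fixing all $i>n$). Write $t=\langle\pi;t_1,..,t_n\rangle$; $\bar\epsilon$ is the one-node tree. $\mathrm{FPT}$ is the monoid of finite permutation trees with unit $\bar\epsilon$ and product: $t\bar\epsilon=t=\bar\epsilon t$; for $t=\langle\pi;t_1..t_n\rangle$, $u=\langle\rho;u_1..u_m\rangle$: if $n\ge m$, $tu=\langle\pi\circ\rho;u_1t_{\rho1},..,u_mt_{\rho m},t_{m+1},..,t_n\rangle$; if $m\ge n$, $tu=\langle\pi\circ\rho;u_1t_{\rho1},..,u_mt_{\rho m}\rangle$ with $t_j:=\bar\epsilon$ for $j>n$. -}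

module Defs where

open import Data.Nat using (ℕ; zero; suc; _⊔_)
open import Data.List using (List; []; _∷_; _++_; map; length; drop; upTo)
open import Data.List.Relation.Unary.All using (All)
open import Data.List.Membership.Propositional using (_∈_)
open import Data.List.Relation.Binary.Permutation.Propositional using (_↭_)
open import Data.Product using (Σ)
open import Relation.Binary.PropositionalEquality using (_≡_)

-- A node  node π ts  has children
-- ts = [t_1,...,t_n] (0-indexed in Agda) and label π, a list of length n
-- listing the values π(0),...,π(n-1) of a permutation of {0,...,n-1}
-- (0-indexed version of a permutation of ℕ⁺ fixing all i > n).
data Tree : Set where
  node : List ℕ → List Tree → Tree

data IsPT : Tree → Set where
  node : ∀ {π ts} → length π ≡ length ts → π ↭ upTo (length ts) →
         All IsPT ts → IsPT (node π ts)

ε̄ : Tree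
ε̄ = node [] []

at : List ℕ → ℕ → ℕ
at [] i = i
at (x ∷ xs) zero = x
at (x ∷ xs) (suc i) = at xs i

mutual
  _·_ : Tree → Tree → Tree
  t · node [] [] = t
  node [] [] · u = u
  node π ts · node ρ us =
    node (map (λ i → at π (at ρ i)) (upTo (length ts ⊔ length us)))
         (kids ts ρ 0 us ++ drop (length us) ts)

  kids : List Tree → List ℕ → ℕ → List Tree → List Tree
  kids ts ρ j [] = []
  kids ts ρ j (u ∷ us) = kidAt u ts (at ρ j) ∷ kids ts ρ (suc j) us

  -- kidAt u ts r = u · t_r, where t_r := ε̄ if r is out of range (and u ε̄ = u)
  kidAt : Tree → List Tree → ℕ → Tree
  kidAt u [] r = u
  kidAt u (t ∷ ts) zero = u · t
  kidAt u (t ∷ ts) (suc r) = kidAt u ts r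

prod : List Tree → Tree
prod [] = ε̄
prod (t ∷ ws) = t · prod ws

⟨_⟩ : List Tree → Tree → Set
⟨ gs ⟩ t = Σ (List Tree) λ ws → All (_∈ gs) ws × prod ws ≡ t
  where open import Data.Product using (_×_)

IsFinite : (Tree → Set) → Set
IsFinite P = Σ (List Tree) λ L → ∀ t → P t → t ∈ L

-- The root of a product a · b has at most as many children, and a label with
-- entries at most as large, as the roots of a and b; each child of a · b is a
-- child of a or b, or a product of such children.  Hence every element of
-- ⟨ gs ⟩ has a root of bounded shape whose children lie in the submonoid
-- generated by the children of the generators.  These have smaller height, so
-- induction on height bounds ⟨ gs ⟩ by a finite enumeration of root shapes.
module Submission where

open import Defs
open import Data.List using (List)
open import Data.List.Relation.Unary.All using (All)

open import Data.Nat using (ℕ; zero; suc; _⊔_; _≤_; _<_; _∸_; _+_; z≤n; s≤s)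
open import Data.Nat.Properties
  using (≤-trans; <-≤-trans; m≤m⊔n; m≤n⊔m; ⊔-lub; +-identityʳ; n≤1+n)
open import Data.List
  using ([]; _∷_; [_]; _++_; map; length; drop; upTo; concatMap; cartesianProductWith)
open import Data.List.Properties using (length-map; length-upTo; length-++; length-drop)
open import Data.List.Extrema.Nat using (max; xs≤max)
open import Data.List.Relation.Unary.All using ([]; _∷_)
import Data.List.Relation.Unary.All as All
open import Data.List.Relation.Unary.All.Properties using (map⁺; ++⁺; drop⁺; concat⁺; all-upTo)
import Data.List.Relation.Unary.Any as Any
open import Data.List.Relation.Unary.Any using (here; there)
open import Data.List.Membership.Propositional using (_∈_)
open import Data.List.Membership.Propositional.Properties
  using (∈-map⁺; ∈-upTo⁺; ∈-concatMap⁺; ∈-cartesianProductWith⁺)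
open import Data.Product using (∃; _,_)
open import Data.Sum using (_⊎_; inj₁; inj₂)
open import Relation.Binary.PropositionalEquality using (_≡_; refl; sym; trans; cong; subst)

m+[n∸m]≡m⊔n : ∀ m n → m + (n ∸ m) ≡ m ⊔ n
m+[n∸m]≡m⊔n zero n = refl
m+[n∸m]≡m⊔n (suc m) zero = cong suc (+-identityʳ m)
m+[n∸m]≡m⊔n (suc m) (suc n) = cong suc (m+[n∸m]≡m⊔n m n)

at-< : ∀ {n} π {i} → All (_< n) π → i < n → at π i < n
at-< [] [] i<n = i<n
at-< (x ∷ π) {zero} (x<n ∷ _) _ = x<n
at-< (x ∷ π) {suc i} (_ ∷ π<n) i+1<n = at-< π π<n (≤-trans (n≤1+n _) i+1<n)

lists≤ : {A : Set} → ℕ → List A → List (List A)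
lists≤ zero xs = [ [] ]
lists≤ (suc n) xs = [] ∷ cartesianProductWith _∷_ xs (lists≤ n xs)

∈-lists≤ : {A : Set} {xs ys : List A} (n : ℕ) →
           length ys ≤ n → All (_∈ xs) ys → ys ∈ lists≤ n xs
∈-lists≤ {ys = []} zero _ _ = here refl
∈-lists≤ {ys = []} (suc n) _ _ = here refl
∈-lists≤ {ys = y ∷ ys} (suc n) (s≤s |ys|≤n) (y∈xs ∷ ys⊆xs) =
  there (∈-cartesianProductWith⁺ _∷_ y∈xs (∈-lists≤ n |ys|≤n ys⊆xs))

children : Tree → List Tree
children (node π ts) = ts

·-ε̄ : ∀ t → t · ε̄ ≡ t
·-ε̄ (node π ts) = refl

ε̄-· : ∀ u → ε̄ · u ≡ u
ε̄-· (node [] []) = refl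
ε̄-· (node [] (_ ∷ _)) = refl
ε̄-· (node (_ ∷ _) _) = refl

·-node : ∀ π ts ρ us →
  node π ts · node ρ us ≡ node π ts ⊎
  node π ts · node ρ us ≡ node ρ us ⊎
  node π ts · node ρ us ≡
    node (map (λ i → at π (at ρ i)) (upTo (length ts ⊔ length us)))
         (kids ts ρ 0 us ++ drop (length us) ts)
·-node π ts [] [] = inj₁ (·-ε̄ (node π ts))
·-node [] [] ρ us@(_ ∷ _) = inj₂ (inj₁ (ε̄-· (node ρ us)))
·-node [] [] ρ@(_ ∷ _) us = inj₂ (inj₁ (ε̄-· (node ρ us)))
·-node [] (_ ∷ _) [] (_ ∷ _) = inj₂ (inj₂ refl)
·-node [] (_ ∷ _) (_ ∷ _) _ = inj₂ (inj₂ refl)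
·-node (_ ∷ _) _ [] (_ ∷ _) = inj₂ (inj₂ refl)
·-node (_ ∷ _) _ (_ ∷ _) _ = inj₂ (inj₂ refl)

length-kids : ∀ ts ρ j us → length (kids ts ρ j us) ≡ length us
length-kids ts ρ j [] = refl
length-kids ts ρ j (u ∷ us) = cong suc (length-kids ts ρ (suc j) us)

length-kids++drop : ∀ ts ρ us →
  length (kids ts ρ 0 us ++ drop (length us) ts) ≡ length us ⊔ length ts
length-kids++drop ts ρ us
  rewrite length-++ (kids ts ρ 0 us) {drop (length us) ts}
        | length-kids ts ρ 0 us
        | length-drop (length us) ts = m+[n∸m]≡m⊔n (length us) (length ts)

module _ {P : Tree → Set} (P-· : ∀ {a b} → P a → P b → P (a · b)) where

  All-kidAt : ∀ {u ts} r → P u → All P ts → P (kidAt u ts r)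
  All-kidAt r pu [] = pu
  All-kidAt zero pu (pt ∷ _) = P-· pu pt
  All-kidAt (suc r) pu (_ ∷ pts) = All-kidAt r pu pts

  All-kids : ∀ {ts us} ρ j → All P ts → All P us → All P (kids ts ρ j us)
  All-kids ρ j pts [] = []
  All-kids ρ j pts (pu ∷ pus) = All-kidAt (at ρ j) pu pts ∷ All-kids ρ (suc j) pts pus

data RootBounded (n : ℕ) (P : Tree → Set) : Tree → Set where
  node : ∀ {π ts} → length π ≤ n → All (_< n) π → length ts ≤ n → All P ts →
         RootBounded n P (node π ts)

RootBounded-mono : ∀ {m n P Q t} → m ≤ n → (∀ {u} → P u → Q u) →
                   RootBounded m P t → RootBounded n Q t
RootBounded-mono m≤n P⇒Q (node |π|≤m π<m |ts|≤m pts) =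
  node (≤-trans |π|≤m m≤n) (All.map (λ x<m → <-≤-trans x<m m≤n) π<m)
       (≤-trans |ts|≤m m≤n) (All.map P⇒Q pts)

ε̄-RootBounded : ∀ {n P} → RootBounded n P ε̄
ε̄-RootBounded = node z≤n [] z≤n []

RootBounded-· : ∀ {n P} → (∀ {a b} → P a → P b → P (a · b)) →
                ∀ {a b} → RootBounded n P a → RootBounded n P b → RootBounded n P (a · b)
RootBounded-· {n} {P} P-· {node π ts} {node ρ us}
  a@(node |π|≤n π<n |ts|≤n pts) b@(node |ρ|≤n ρ<n |us|≤n pus)
  with ·-node π ts ρ us
... | inj₁ ab≡a = subst (RootBounded n P) (sym ab≡a) a
... | inj₂ (inj₁ ab≡b) = subst (RootBounded n P) (sym ab≡b) b
... | inj₂ (inj₂ ab≡) = subst (RootBounded n P) (sym ab≡)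
  (node |πρ|≤n πρ<n |kids|≤n (++⁺ (All-kids P-· ρ 0 pts pus) (drop⁺ (length us) pts)))
  where
  m = length ts ⊔ length us
  m≤n : m ≤ n
  m≤n = ⊔-lub |ts|≤n |us|≤n
  |πρ|≤n = subst (_≤ n) (sym (trans (length-map _ (upTo m)) (length-upTo m))) m≤n
  πρ<n = map⁺ (All.map (λ i<m → at-< π π<n (at-< ρ ρ<n (<-≤-trans i<m m≤n))) (all-upTo m))
  |kids|≤n = subst (_≤ n) (sym (length-kids++drop ts ρ us)) (⊔-lub |us|≤n |ts|≤n)

rootBoundedTrees : ℕ → List Tree → List Tree
rootBoundedTrees n ts = cartesianProductWith node (lists≤ n (upTo n)) (lists≤ n ts)

∈-rootBoundedTrees : ∀ {n P ts t} → (∀ {u} → P u → u ∈ ts) →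
                     RootBounded n P t → t ∈ rootBoundedTrees n ts
∈-rootBoundedTrees {n} P⊆ts (node |π|≤n π<n |us|≤n pus) =
  ∈-cartesianProductWith⁺ node (∈-lists≤ n |π|≤n (All.map ∈-upTo⁺ π<n))
                               (∈-lists≤ n |us|≤n (All.map P⊆ts pus))

rootBound : Tree → ℕ
rootBound (node π ts) = suc (max 0 π) ⊔ length π ⊔ length ts

maxRootBound : List Tree → ℕ
maxRootBound ts = max 0 (map rootBound ts)

rootBounded : ∀ t → RootBounded (rootBound t) (_∈ children t) t
rootBounded (node π ts) = node |π|≤ π< (m≤n⊔m _ (length ts)) (All.tabulate (λ t∈ts → t∈ts))
  where
  |π|≤ = ≤-trans (m≤n⊔m (suc (max 0 π)) (length π)) (m≤m⊔n _ (length ts))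
  π< = All.map (λ x≤max → ≤-trans (s≤s x≤max)
                 (≤-trans (m≤m⊔n _ (length π)) (m≤m⊔n _ (length ts))))
               (xs≤max 0 π)

data Generated (gs : List Tree) : Tree → Set where
  gen : ∀ {t} → t ∈ gs → Generated gs t
  unit : Generated gs ε̄
  mul : ∀ {a b} → Generated gs a → Generated gs b → Generated gs (a · b)

Generated-least : ∀ {gs} {Q : Tree → Set} → (∀ {g} → g ∈ gs → Q g) → Q ε̄ →
                  (∀ {a b} → Q a → Q b → Q (a · b)) → ∀ {t} → Generated gs t → Q t
Generated-least Q-gs Q-ε̄ Q-· (gen t∈gs) = Q-gs t∈gs
Generated-least Q-gs Q-ε̄ Q-· unit = Q-ε̄
Generated-least Q-gs Q-ε̄ Q-· (mul ga gb) =
  Q-· (Generated-least Q-gs Q-ε̄ Q-· ga) (Generated-least Q-gs Q-ε̄ Q-· gb)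

prod∈Generated : ∀ {gs ws} → All (_∈ gs) ws → Generated gs (prod ws)
prod∈Generated [] = unit
prod∈Generated (w∈gs ∷ ws⊆gs) = mul (gen w∈gs) (prod∈Generated ws⊆gs)

Generated-[] : ∀ {t} → Generated [] t → t ≡ ε̄
Generated-[] = Generated-least {Q = _≡ ε̄} (λ ()) refl (λ { refl refl → refl })

Generated⊆RootBounded : ∀ gs {t} → Generated gs t →
  RootBounded (maxRootBound gs) (Generated (concatMap children gs)) t
Generated⊆RootBounded gs = Generated-least generator ε̄-RootBounded (RootBounded-· mul)
  where
  generator : ∀ {g} → g ∈ gs →
    RootBounded (maxRootBound gs) (Generated (concatMap children gs)) g
  generator g∈gs =
    RootBounded-mono (All.lookup (xs≤max 0 (map rootBound gs)) (∈-map⁺ rootBound g∈gs))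
      (λ u∈g → gen (∈-concatMap⁺ children (Any.map (λ { refl → u∈g }) g∈gs)))
      (rootBounded _)

data HeightBelow : ℕ → Tree → Set where
  node : ∀ {h π ts} → All (HeightBelow h) ts → HeightBelow (suc h) (node π ts)

HeightBelow-mono : ∀ {h h′ t} → h ≤ h′ → HeightBelow h t → HeightBelow h′ t
HeightBelow-mono (s≤s h≤h′) (node ts<h) = node (All.map (HeightBelow-mono h≤h′) ts<h)

heightBelow : ∀ t → ∃ λ h → HeightBelow h t
heightsBelow : ∀ ts → ∃ λ h → All (HeightBelow h) ts
heightBelow (node π ts) with heightsBelow ts
... | h , ts<h = suc h , node ts<h
heightsBelow [] = 0 , []
heightsBelow (t ∷ ts) with heightBelow t | heightsBelow ts
... | h , t<h | h′ , ts<h′ =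
  h ⊔ h′ , HeightBelow-mono (m≤m⊔n h h′) t<h
        ∷ All.map (HeightBelow-mono (m≤n⊔m h h′)) ts<h′

Generated-finite : ∀ h {gs} → All (HeightBelow h) gs → IsFinite (Generated gs)
Generated-finite zero [] = [ ε̄ ] , λ t g → here (Generated-[] g)
Generated-finite (suc h) {gs} gs<h
  with Generated-finite h (concat⁺ (map⁺ (All.map (λ { (node ts<h) → ts<h }) gs<h)))
... | L , children⊆L =
  rootBoundedTrees (maxRootBound gs) L ,
  λ t g → ∈-rootBoundedTrees (children⊆L _) (Generated⊆RootBounded gs g)

-- The proof does not use that the labels are permutations.
proposition3p15 : (gs : List Tree) → All IsPT gs → IsFinite ⟨ gs ⟩
proposition3p15 gs _ with heightsBelow gs
... | h , gs<h with Generated-finite h gs<h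
... | L , generated⊆L = L , λ { t (ws , ws⊆gs , refl) → generated⊆L t (prod∈Generated ws⊆gs) }
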